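{- For every $F\in\mathcal{F}_n$, the bijection $\delta_{213}$ restricts to a bijection between $\mathcal{R}_F(213,321)$ and $\mathcal{A}^2_F$.
   Context: A Dyck path of semilength $n$ is a lattice path from $(0,n)$ to $(n,0)$ with unit east and south steps never going strictly below $y=n-x$. $\mathcal{F}_n$ is the set of Ferrers boards (left-justified arrays of unit squares bounded by the coordinate axes and such a path) whose border $D_F$ is such a path. A full rook placement $R$ on $F$ has exactly one square in each row and column of $F$; $\Gamma(V)$ for $V=(a,b)$ is the set of unit squares in $[0,a]\times[0,b]$; a set of squares with at most one per row and column determines a permutation by standardization. $R$ avoids $\tau$ if for every border vertex $V$ the permutation determined by $R\cap\Gamma(V)$ avoids $\tau$; $\mathcal{R}_F(213)$ and $\mathcal{R}_F(213,321)$ denote the full rook placements on $F$ avoiding $213$, resp. both $213$ and $321$. $\delta_{213}:\mathcal{R}_F(213)\to\mathcal{D}^2_F$ sends $R$ to $(D_{F_R},D_F)$, where $F_R$ is the smallest Ferrers board containing $R$ and $\mathcal{D}^2_F$ is the set of pairs $(D_0,D_F)$ with $D_0$ a Dyck path of semilength $n$ never strictly above $D_F$; it is a bijection. A peak of a Dyck path is a vertex preceded by an east step and followed by a south step. $\mathcal{A}^2_F$ is the set of $(D_0,D_F)\in\mathcal{D}^2_F$ such that for every vertex $V$ on $D_F$, $D_0$ has no peak lying strictly south and strictly west of $V$. -}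

module Defs where

open import Data.Nat using (ℕ; zero; suc; _+_; _∸_; _<_; _≤_)
open import Data.Fin as Fin using (Fin; toℕ)
open import Data.Vec using (Vec; lookup; _∷_; [])
open import Data.List using (List; []; _∷_)
open import Data.List.Membership.Propositional using (_∈_)
open import Data.Product using (Σ; _×_; _,_; ∃; ∃-syntax)
open import Relation.Nullary using (¬_)
open import Relation.Binary.PropositionalEquality using (_≡_)

-- Lattice paths.  A path is a list of unit steps, East (x+1) or South (y-1).
-- Points are pairs (x , y) of naturals.

data Step : Set where
  E S : Step

Point : Set
Point = ℕ × ℕ

#E : List Step → ℕ
#E []      = 0
#E (E ∷ p) = suc (#E p)
#E (S ∷ p) = #E p

#S : List Step → ℕ
#S []      = 0
#S (E ∷ p) = #S p
#S (S ∷ p) = suc (#S p)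

-- "never strictly below y = n - x" for a path starting at (0,n):
-- after any prefix with e East and s South steps the point is (e, n - s),
-- and n - s ≥ n - e  iff  s ≤ e.  We track the running difference e - s.
NeverBelow : ℕ → List Step → Set
NeverBelow d []      = Data.Unit.⊤ where import Data.Unit
NeverBelow d (E ∷ p) = NeverBelow (suc d) p
NeverBelow zero    (S ∷ p) = Data.Empty.⊥ where import Data.Empty
NeverBelow (suc d) (S ∷ p) = NeverBelow d p

IsDyck : ℕ → List Step → Set
IsDyck n p = (#E p ≡ n) × (#S p ≡ n) × NeverBelow 0 p

vertsFrom : ℕ → ℕ → List Step → List Point
vertsFrom x y []      = (x , y) ∷ []
vertsFrom x y (E ∷ p) = (x , y) ∷ vertsFrom (suc x) y p
vertsFrom x y (S ∷ p) = (x , y) ∷ vertsFrom x (y ∸ 1) p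

verts : ℕ → List Step → List Point
verts n p = vertsFrom 0 n p

peaksFrom : ℕ → ℕ → List Step → List Point
peaksFrom x y []           = []
peaksFrom x y (E ∷ [])     = []
peaksFrom x y (E ∷ E ∷ p)  = peaksFrom (suc x) y (E ∷ p)
peaksFrom x y (E ∷ S ∷ p)  = (suc x , y) ∷ peaksFrom (suc x) y (S ∷ p)
peaksFrom x y (S ∷ p)      = peaksFrom x (y ∸ 1) p

peaks : ℕ → List Step → List Point
peaks n p = peaksFrom 0 n p

-- Ferrers board bounded by the axes and a path D started at (0,n):
-- column i (the strip [i,i+1] × [0,∞)) has height equal to the
-- y-coordinate of the (i+1)-st East step of D.  Square (i , j) denotes the
-- unit square [i,i+1] × [j,j+1].

colHFrom : ℕ → List Step → ℕ → ℕ
colHFrom y []      i       = 0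
colHFrom y (E ∷ p) zero    = y
colHFrom y (E ∷ p) (suc i) = colHFrom y p i
colHFrom y (S ∷ p) i       = colHFrom (y ∸ 1) p i

colH : ℕ → List Step → ℕ → ℕ
colH n D i = colHFrom n D i

InBoard : ℕ → List Step → ℕ → ℕ → Set
InBoard n D i j = j < colH n D i

-- A rook placement with exactly one square per row and column is
-- recorded as σ : the rook of column i lies in row (lookup σ i);
-- injectivity = at most one per row; with n columns and n rows this gives
-- exactly one per row and column.

RookPlacement : (n : ℕ) → List Step → Vec (Fin n) n → Set
RookPlacement n D σ =
  (∀ i j → lookup σ i ≡ lookup σ j → i ≡ j) ×
  (∀ i → InBoard n D (toℕ i) (toℕ (lookup σ i)))

-- Γ(V) for V = (a , b): rook of column i lies in [0,a] × [0,b]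
InΓ : {n : ℕ} → Vec (Fin n) n → Point → Fin n → Set
InΓ σ (a , b) i = (toℕ i < a) × (toℕ (lookup σ i) < b)

-- The permutation obtained by standardizing R ∩ Γ(V) contains the pattern
-- τ (a permutation of length k) iff there are k columns c 0 < … < c (k-1)
-- whose rooks lie in Γ(V) and whose rows are ordered as τ.
ContainsIn : {n k : ℕ} → Vec (Fin k) k → Vec (Fin n) n → Point → Set
ContainsIn {n} {k} τ σ V =
  Σ (Fin k → Fin n) λ c →
    (∀ p q → p Fin.< q → c p Fin.< c q) ×
    (∀ p → InΓ σ V (c p)) ×
    (∀ p q → (lookup τ p Fin.< lookup τ q → lookup σ (c p) Fin.< lookup σ (c q)) ×
             (lookup σ (c p) Fin.< lookup σ (c q) → lookup τ p Fin.< lookup τ q))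

Avoids : {n k : ℕ} → List Step → Vec (Fin k) k → Vec (Fin n) n → Set
Avoids {n} D τ σ = ∀ V → V ∈ verts n D → ¬ ContainsIn τ σ V

-- the patterns 213 and 321 (written 0-based)
p213 : Vec (Fin 3) 3
p213 = Fin.suc Fin.zero ∷ Fin.zero ∷ Fin.suc (Fin.suc Fin.zero) ∷ []

p321 : Vec (Fin 3) 3
p321 = Fin.suc (Fin.suc Fin.zero) ∷ Fin.suc Fin.zero ∷ Fin.zero ∷ []

R213 : (n : ℕ) → List Step → Vec (Fin n) n → Set
R213 n D σ = RookPlacement n D σ × Avoids D p213 σ

R213-321 : (n : ℕ) → List Step → Vec (Fin n) n → Set
R213-321 n D σ = RookPlacement n D σ × Avoids D p213 σ × Avoids D p321 σ

IsBorderOfFR : (n : ℕ) → Vec (Fin n) n → List Step → Set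
IsBorderOfFR n σ D0 =
  IsDyck n D0 ×
  (∀ i → InBoard n D0 (toℕ i) (toℕ (lookup σ i))) ×
  (∀ D → IsDyck n D → (∀ i → InBoard n D (toℕ i) (toℕ (lookup σ i))) →
     ∀ i j → InBoard n D0 i j → InBoard n D i j)

InD2 : ℕ → List Step → List Step → Set
InD2 n D0 DF = IsDyck n D0 × (∀ i → colH n D0 i ≤ colH n DF i)

InA2 : ℕ → List Step → List Step → Set
InA2 n D0 DF =
  InD2 n D0 DF ×
  (∀ V → V ∈ verts n DF → ∀ P → P ∈ peaks n D0 →
     ¬ ((Data.Product.proj₁ P < Data.Product.proj₁ V) ×
        (Data.Product.proj₂ P < Data.Product.proj₂ V)))
  where import Data.Product

-- The border of F_R has as column heights the suffix maxima of the rows of R (plus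
-- one).  If R avoids 213 at the corners of the border of F, each rook lies as high
-- as possible in its column given the rooks to its right, so R is the unique
-- greedy placement under its border; conversely the greedy placement under any
-- Dyck path D0 avoids 213 and has border D0.  Under this correspondence an
-- occurrence of 321 in Γ(V) amounts to a descent of the column heights, i.e. a
-- peak of D0, strictly south-west of V.

module Submission where

open import Defs
open import Data.Nat using (ℕ; zero; suc; _+_; _∸_; _<_; _≤_; _≤′_; ≤′-refl; ≤′-step; _⊔_; pred; z≤n; s≤s; z<s; _≟_; _<?_; _≤?_)
open import Data.Nat.Properties
open import Data.Fin as Fin using (Fin; toℕ; fromℕ<)
open import Data.Fin.Patterns using (0F; 1F; 2F)
import Data.Fin.Properties as Finₚ
open import Data.Fin.Induction using (>-wellFounded)
open import Data.Vec using (Vec; lookup; tabulate; _∷_; [])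
open import Data.Vec.Properties using (lookup∘tabulate; tabulate∘lookup; tabulate-cong)
open import Data.List using (List; []; _∷_)
open import Data.List.Membership.Propositional using (_∈_)
open import Data.List.Relation.Unary.Any using (here; there)
open import Data.Product using (Σ; ∃; _×_; _,_; proj₁; proj₂)
open import Data.Sum using (_⊎_; inj₁; inj₂)
open import Data.Empty using (⊥; ⊥-elim)
open import Data.Unit using (tt)
open import Function using (_∘_)
open import Induction.WellFounded using (Acc; acc)
open import Relation.Nullary using (¬_; yes; no; contradiction)
open import Relation.Nullary.Decidable using (toWitness; _→-dec_)
open import Relation.Binary.PropositionalEquality using (_≡_; _≢_; refl; sym; trans; cong; subst; subst₂; module ≡-Reasoning)
open import Relation.Binary.Definitions using (tri<; tri≈; tri>)

Antitone : (ℕ → ℕ) → Set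
Antitone h = ∀ i → h (suc i) ≤ h i

antitone-≤′ : ∀ {h} → Antitone h → ∀ {i j} → i ≤′ j → h j ≤ h i
antitone-≤′ anti ≤′-refl        = ≤-refl
antitone-≤′ anti (≤′-step i≤′j) = ≤-trans (anti _) (antitone-≤′ anti i≤′j)

antitone-≤ : ∀ {h} → Antitone h → ∀ {i j} → i ≤ j → h j ≤ h i
antitone-≤ anti = antitone-≤′ anti ∘ ≤⇒≤′

antitone-descent : ∀ {h} → Antitone h → ∀ {i j} → i ≤′ j → h j < h i →
  ∃ λ k → i ≤ k × k < j × h (suc k) < h k × h k ≡ h i
antitone-descent anti ≤′-refl hi<hi = contradiction hi<hi (<-irrefl refl)
antitone-descent {h} anti {i} (≤′-step {j} i≤′j) hj+1<hi
  with m≤n⇒m<n∨m≡n (antitone-≤′ anti i≤′j)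
... | inj₁ hj<hi =
  let k , i≤k , k<j , drop , hk≡hi = antitone-descent anti i≤′j hj<hi
  in k , i≤k , m<n⇒m<1+n k<j , drop , hk≡hi
... | inj₂ hj≡hi = j , ≤′⇒≤ i≤′j , n<1+n j , subst (h (suc j) <_) (sym hj≡hi) hj+1<hi , hj≡hi

pred-< : ∀ {a} → 0 < a → pred a < a
pred-< {suc a} _ = n<1+n a

suc-pred-> : ∀ {a} → 0 < a → suc (pred a) ≡ a
suc-pred-> {suc a} _ = refl

toℕ-onto : ∀ {k n} → k < n → ∃ λ (K : Fin n) → toℕ K ≡ k
toℕ-onto k<n = fromℕ< k<n , Finₚ.toℕ-fromℕ< k<n

injective⇒surjective : ∀ {n} (f : Fin n → Fin n) → (∀ i j → f i ≡ f j → i ≡ j) →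
  ∀ r → ∃ λ c → f c ≡ r
injective⇒surjective {suc m} f inj r with Finₚ.any? (λ c → f c Finₚ.≟ r)
... | yes hit  = hit
... | no  miss = contradiction (Finₚ.injective⇒≤ {f = squeeze} squeeze-injective) (<-irrefl refl)
  where
  squeeze : Fin (suc m) → Fin m
  squeeze c = Fin.punchOut {i = r} {j = f c} (λ r≡fc → miss (c , sym r≡fc))
  squeeze-injective : ∀ {c d} → squeeze c ≡ squeeze d → c ≡ d
  squeeze-injective {c} {d} = inj c d ∘ Finₚ.punchOut-injective (λ r≡fc → miss (c , sym r≡fc)) (λ r≡fd → miss (d , sym r≡fd))

colHFrom-≤ : ∀ y p i → colHFrom y p i ≤ y
colHFrom-≤ y []      i       = z≤n
colHFrom-≤ y (E ∷ p) zero    = ≤-refl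
colHFrom-≤ y (E ∷ p) (suc i) = colHFrom-≤ y p i
colHFrom-≤ y (S ∷ p) i       = ≤-trans (colHFrom-≤ (y ∸ 1) p i) (m∸n≤m y 1)

colHFrom-antitone : ∀ y p → Antitone (colHFrom y p)
colHFrom-antitone y []      i       = z≤n
colHFrom-antitone y (E ∷ p) zero    = colHFrom-≤ y p 0
colHFrom-antitone y (E ∷ p) (suc i) = colHFrom-antitone y p i
colHFrom-antitone y (S ∷ p) i       = colHFrom-antitone (y ∸ 1) p i

colHFrom-beyond : ∀ y p {i} → #E p ≤ i → colHFrom y p i ≡ 0
colHFrom-beyond y []      _           = refl
colHFrom-beyond y (E ∷ p) {suc i} (s≤s #E≤i) = colHFrom-beyond y p #E≤i
colHFrom-beyond y (S ∷ p) #E≤i        = colHFrom-beyond (y ∸ 1) p #E≤i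

-- d is the excess of East over South steps so far, so at most i + d South steps
-- precede the (i+1)-st East step.
colHFrom-lower : ∀ d y p i → NeverBelow d p → i < #E p → y ∸ (i + d) ≤ colHFrom y p i
colHFrom-lower d y (E ∷ p) zero nb _ = m∸n≤m y d
colHFrom-lower d y (E ∷ p) (suc i) nb (s≤s i<#E) =
  subst (λ s → y ∸ s ≤ colHFrom y p i) (+-suc i d) (colHFrom-lower (suc d) y p i nb i<#E)
colHFrom-lower (suc d) y (S ∷ p) i nb i<#E =
  subst (_≤ colHFrom (y ∸ 1) p i)
    (trans (∸-+-assoc y 1 (i + d)) (cong (y ∸_) (sym (+-suc i d))))
    (colHFrom-lower d (y ∸ 1) p i nb i<#E)

dyck-colH-lower : ∀ {n D} → IsDyck n D → ∀ {i} → i < n → n ≤ colH n D i + i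
dyck-colH-lower {n} {D} (#E≡n , _ , nb) {i} i<n = begin
  n                ≤⟨ m≤n+m∸n n i ⟩
  i + (n ∸ i)      ≤⟨ +-monoʳ-≤ i (subst (λ s → n ∸ s ≤ colH n D i) (+-identityʳ i)
                        (colHFrom-lower 0 n D i nb (subst (i <_) (sym #E≡n) i<n))) ⟩
  i + colH n D i   ≡⟨ +-comm i _ ⟩
  colH n D i + i   ∎
  where open ≤-Reasoning

dyck-colH-beyond : ∀ {n D i} → IsDyck n D → n ≤ i → colH n D i ≡ 0
dyck-colH-beyond {n} {D} (#E≡n , _) n≤i = colHFrom-beyond n D (subst (_≤ _) (sym #E≡n) n≤i)

vertsFrom-start : ∀ x y p → (x , y) ∈ vertsFrom x y p
vertsFrom-start x y []      = here refl
vertsFrom-start x y (E ∷ p) = here refl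
vertsFrom-start x y (S ∷ p) = here refl

vertsFrom-corner : ∀ x y p k → k < #E p → (x + suc k , colHFrom y p k) ∈ vertsFrom x y p
vertsFrom-corner x y (E ∷ p) zero _ =
  there (subst (λ a → (a , y) ∈ vertsFrom (suc x) y p) (sym (+-comm x 1)) (vertsFrom-start (suc x) y p))
vertsFrom-corner x y (E ∷ p) (suc k) (s≤s k<#E) =
  there (subst (λ a → (a , colHFrom y p k) ∈ vertsFrom (suc x) y p) (sym (+-suc x (suc k)))
          (vertsFrom-corner (suc x) y p k k<#E))
vertsFrom-corner x y (S ∷ p) k k<#E = there (vertsFrom-corner x (y ∸ 1) p k k<#E)

vertsFrom-bounded : ∀ x y p {a b} → (a , b) ∈ vertsFrom x y p → a ≤ x + #E p × b ≤ y
vertsFrom-bounded x y []      (here refl) = m≤m+n x 0 , ≤-refl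
vertsFrom-bounded x y (E ∷ p) (here refl) = m≤m+n x _ , ≤-refl
vertsFrom-bounded x y (E ∷ p) {a} (there V∈) =
  let a≤ , b≤ = vertsFrom-bounded (suc x) y p V∈ in subst (a ≤_) (sym (+-suc x (#E p))) a≤ , b≤
vertsFrom-bounded x y (S ∷ p) (here refl) = m≤m+n x _ , ≤-refl
vertsFrom-bounded x y (S ∷ p) (there V∈) =
  let a≤ , b≤ = vertsFrom-bounded x (y ∸ 1) p V∈ in a≤ , ≤-trans b≤ (m∸n≤m y 1)

peaksFrom-descent : ∀ x y p {P} → P ∈ peaksFrom x y p →
  ∃ λ i → P ≡ (x + suc i , colHFrom y p i) × i < #E p ×
          (colHFrom y p (suc i) < colHFrom y p i ⊎ colHFrom y p i ≡ 0)
peaksFrom-descent x y (E ∷ E ∷ p) P∈ =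
  let i , P≡ , i<#E , drop = peaksFrom-descent (suc x) y (E ∷ p) P∈
  in suc i , trans P≡ (cong (_, colHFrom y (E ∷ p) i) (sym (+-suc x (suc i)))) , s≤s i<#E , drop
peaksFrom-descent x y (E ∷ S ∷ p) (here refl) =
  0 , cong (_, y) (+-comm 1 x) , z<s , drop y
  where
  drop : ∀ y → colHFrom (y ∸ 1) p 0 < y ⊎ y ≡ 0
  drop zero    = inj₂ refl
  drop (suc y) = inj₁ (s≤s (colHFrom-≤ y p 0))
peaksFrom-descent x y (E ∷ S ∷ p) (there P∈) =
  let i , P≡ , i<#E , drop = peaksFrom-descent (suc x) y (S ∷ p) P∈
  in suc i , trans P≡ (cong (_, colHFrom y (S ∷ p) i) (sym (+-suc x (suc i)))) , s≤s i<#E , drop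
peaksFrom-descent x y (S ∷ p) P∈ = peaksFrom-descent x (y ∸ 1) p P∈

peaksFrom-intro : ∀ x y p i → suc i < #E p → colHFrom y p (suc i) < colHFrom y p i →
  (x + suc i , colHFrom y p i) ∈ peaksFrom x y p
peaksFrom-intro x y (E ∷ E ∷ p) zero    _ drop = contradiction drop (<-irrefl refl)
peaksFrom-intro x y (E ∷ S ∷ p) zero    _ _    = here (cong (_, y) (+-comm x 1))
peaksFrom-intro x y (E ∷ E ∷ p) (suc i) (s≤s i+1<#E) drop =
  subst (λ a → (a , colHFrom y (E ∷ p) i) ∈ peaksFrom (suc x) y (E ∷ p)) (sym (+-suc x (suc i)))
    (peaksFrom-intro (suc x) y (E ∷ p) i i+1<#E drop)
peaksFrom-intro x y (E ∷ S ∷ p) (suc i) (s≤s i+1<#E) drop =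
  there (subst (λ a → (a , colHFrom y (S ∷ p) i) ∈ peaksFrom (suc x) y (S ∷ p)) (sym (+-suc x (suc i)))
    (peaksFrom-intro (suc x) y (S ∷ p) i i+1<#E drop))
peaksFrom-intro x y (E ∷ []) i (s≤s ()) _
peaksFrom-intro x y (S ∷ p)  i i+1<#E drop = peaksFrom-intro x (y ∸ 1) p i i+1<#E drop

-- The Dyck path with prescribed column heights

record Admissible (n : ℕ) (h : ℕ → ℕ) : Set where
  field
    antitone         : Antitone h
    reaches-diagonal : ∀ {i} → i < n → n ≤ h i + i

dyck-admissible : ∀ {n D} → IsDyck n D → Admissible n (colH n D)
dyck-admissible {n} {D} dy = record
  { antitone = colHFrom-antitone n D ; reaches-diagonal = dyck-colH-lower {D = D} dy }

descend : ℕ → List Step → List Step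
descend zero    q = q
descend (suc t) q = S ∷ descend t q

#E-descend : ∀ t q → #E (descend t q) ≡ #E q
#E-descend zero    q = refl
#E-descend (suc t) q = #E-descend t q

#S-descend : ∀ t q → #S (descend t q) ≡ t + #S q
#S-descend zero    q = refl
#S-descend (suc t) q = cong suc (#S-descend t q)

colHFrom-descend : ∀ y t q i → colHFrom y (descend t q) i ≡ colHFrom (y ∸ t) q i
colHFrom-descend y zero    q i = refl
colHFrom-descend y (suc t) q i =
  trans (colHFrom-descend (y ∸ 1) t q i) (cong (λ z → colHFrom z q i) (∸-+-assoc y 1 t))

NeverBelow-descend : ∀ d t q → t ≤ d → NeverBelow (d ∸ t) q → NeverBelow d (descend t q)
NeverBelow-descend d       zero    q _         nb = nb
NeverBelow-descend (suc d) (suc t) q (s≤s t≤d) nb = NeverBelow-descend d t q t≤d nb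

heightsPath : ℕ → ℕ → (ℕ → ℕ) → List Step
heightsPath zero    y h = descend y []
heightsPath (suc k) y h = descend (y ∸ h 0) (E ∷ heightsPath k (h 0) (h ∘ suc))

#E-heightsPath : ∀ k y h → #E (heightsPath k y h) ≡ k
#E-heightsPath zero    y h = #E-descend y []
#E-heightsPath (suc k) y h = trans (#E-descend (y ∸ h 0) _) (cong suc (#E-heightsPath k (h 0) _))

#S-heightsPath : ∀ k y h → Antitone h → h 0 ≤ y → #S (heightsPath k y h) ≡ y
#S-heightsPath zero    y h _    _     = trans (#S-descend y []) (+-identityʳ y)
#S-heightsPath (suc k) y h anti h0≤y = begin
  #S (descend (y ∸ h 0) (E ∷ heightsPath k (h 0) (h ∘ suc)))  ≡⟨ #S-descend (y ∸ h 0) _ ⟩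
  y ∸ h 0 + #S (heightsPath k (h 0) (h ∘ suc))              ≡⟨ cong (y ∸ h 0 +_) (#S-heightsPath k (h 0) _ (anti ∘ suc) (anti 0)) ⟩
  y ∸ h 0 + h 0                                             ≡⟨ m∸n+n≡m h0≤y ⟩
  y                                                         ∎
  where open ≡-Reasoning

colHFrom-heightsPath : ∀ k y h → Antitone h → h 0 ≤ y → ∀ {i} → i < k → colHFrom y (heightsPath k y h) i ≡ h i
colHFrom-heightsPath (suc k) y h anti h0≤y {zero} _ =
  trans (colHFrom-descend y (y ∸ h 0) _ 0) (m∸[m∸n]≡n h0≤y)
colHFrom-heightsPath (suc k) y h anti h0≤y {suc i} (s≤s i<k) = begin
  colHFrom y (heightsPath (suc k) y h) (suc i)              ≡⟨ colHFrom-descend y (y ∸ h 0) _ (suc i) ⟩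
  colHFrom (y ∸ (y ∸ h 0)) (heightsPath k (h 0) (h ∘ suc)) i ≡⟨ cong (λ z → colHFrom z (heightsPath k (h 0) (h ∘ suc)) i) (m∸[m∸n]≡n h0≤y) ⟩
  colHFrom (h 0) (heightsPath k (h 0) (h ∘ suc)) i           ≡⟨ colHFrom-heightsPath k (h 0) (h ∘ suc) (anti ∘ suc) (anti 0) i<k ⟩
  h (suc i)                                                  ∎
  where open ≡-Reasoning

NeverBelow-heightsPath : ∀ k y h d → Antitone h → h 0 ≤ y →
  (∀ {i} → i < k → y ≤ (h i + i) + d) → y ≤ k + d → NeverBelow d (heightsPath k y h)
NeverBelow-heightsPath zero    y h d _    _     _     y≤d = NeverBelow-descend d y [] y≤d tt
NeverBelow-heightsPath (suc k) y h d anti h0≤y above y≤k+d =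
  NeverBelow-descend d t _ t≤d
    (NeverBelow-heightsPath k (h 0) (h ∘ suc) (suc (d ∸ t)) (anti ∘ suc) (anti 0) above′ bound′)
  where
  t : ℕ
  t = y ∸ h 0
  t≤d : t ≤ d
  t≤d = m≤n+o⇒m∸n≤o y (h 0) (subst (λ z → y ≤ z + d) (+-identityʳ (h 0)) (above z<s))
  shift : ∀ x → y ≤ x + d → h 0 ≤ x + (d ∸ t)
  shift x y≤x+d = +-cancelʳ-≤ t (h 0) (x + (d ∸ t)) (subst₂ _≤_
    (trans (sym (m∸n+n≡m h0≤y)) (+-comm t (h 0)))
    (trans (cong (x +_) (sym (m∸n+n≡m t≤d))) (sym (+-assoc x _ _))) y≤x+d)
  above′ : ∀ {i} → i < k → h 0 ≤ (h (suc i) + i) + suc (d ∸ t)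
  above′ {i} i<k = subst (h 0 ≤_)
    (trans (cong (_+ (d ∸ t)) (+-suc (h (suc i)) i)) (sym (+-suc _ _)))
    (shift (h (suc i) + suc i) (above (s≤s i<k)))
  bound′ : h 0 ≤ k + suc (d ∸ t)
  bound′ = subst (h 0 ≤_) (sym (+-suc k _)) (shift (suc k) y≤k+d)

heightsPath-dyck : ∀ {n h} → Admissible n h → h 0 ≤ n → IsDyck n (heightsPath n n h)
heightsPath-dyck {n} {h} adm h0≤n =
  #E-heightsPath n n h , #S-heightsPath n n h antitone h0≤n ,
  NeverBelow-heightsPath n n h 0 antitone h0≤n
    (λ i<n → subst (n ≤_) (sym (+-identityʳ _)) (reaches-diagonal i<n))
    (subst (n ≤_) (sym (+-identityʳ n)) ≤-refl)
  where open Admissible adm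

row : ∀ {n} → Vec (Fin n) n → Fin n → ℕ
row σ i = toℕ (lookup σ i)

DistinctRows : ∀ {n} → Vec (Fin n) n → Set
DistinctRows σ = ∀ i j → lookup σ i ≡ lookup σ j → i ≡ j

record Triple {n} (σ : Vec (Fin n) n) (V : Point) : Set where
  constructor triple
  field
    a b c : Fin n
    a<b   : a Fin.< b
    b<c   : b Fin.< c
    a∈Γ   : InΓ σ V a
    b∈Γ   : InΓ σ V b
    c∈Γ   : InΓ σ V c

  column : Fin 3 → Fin n
  column 0F = a
  column 1F = b
  column 2F = c

p213-injective : ∀ p q → lookup p213 p ≡ lookup p213 q → p ≡ q
p213-injective = toWitness {a? = Finₚ.all? λ p → Finₚ.all? λ q →
  (lookup p213 p Finₚ.≟ lookup p213 q) →-dec (p Finₚ.≟ q)} tt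

p321-injective : ∀ p q → lookup p321 p ≡ lookup p321 q → p ≡ q
p321-injective = toWitness {a? = Finₚ.all? λ p → Finₚ.all? λ q →
  (lookup p321 p Finₚ.≟ lookup p321 q) →-dec (p Finₚ.≟ q)} tt

module _ {n} {σ : Vec (Fin n) n} {V : Point} where

  contains-intro : (τ : Vec (Fin 3) 3) → (∀ p q → lookup τ p ≡ lookup τ q → p ≡ q) →
    (t : Triple σ V) → let open Triple t in
    (∀ p q → lookup τ p Fin.< lookup τ q → row σ (column p) < row σ (column q)) →
    ContainsIn τ σ V
  contains-intro τ τ-injective t ordered = column , increasing , inΓ , λ p q → ordered p q , reflect p q
    where
    open Triple t
    increasing : ∀ p q → p Fin.< q → column p Fin.< column q
    increasing 0F 1F _ = a<b
    increasing 0F 2F _ = <-trans a<b b<c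
    increasing 1F 2F _ = b<c
    increasing 0F 0F ()
    increasing 1F 0F ()
    increasing 1F 1F (s≤s ())
    increasing 2F 0F ()
    increasing 2F 1F (s≤s ())
    increasing 2F 2F (s≤s (s≤s ()))
    inΓ : ∀ p → InΓ σ V (column p)
    inΓ 0F = a∈Γ
    inΓ 1F = b∈Γ
    inΓ 2F = c∈Γ
    reflect : ∀ p q → row σ (column p) < row σ (column q) → lookup τ p Fin.< lookup τ q
    reflect p q r< with Finₚ.<-cmp (lookup τ p) (lookup τ q)
    ... | tri< τp<τq _ _ = τp<τq
    ... | tri≈ _ τp≡τq _ = contradiction (cong (row σ ∘ column) (τ-injective p q τp≡τq)) (<⇒≢ r<)
    ... | tri> _ _ τq<τp = contradiction (ordered q p τq<τp) (<-asym r<)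

  contains213-intro : (t : Triple σ V) → let open Triple t in
    row σ b < row σ a → row σ a < row σ c → ContainsIn p213 σ V
  contains213-intro t b<a a<c = contains-intro p213 p213-injective t ordered
    where
    open Triple t
    ordered : ∀ p q → lookup p213 p Fin.< lookup p213 q → row σ (column p) < row σ (column q)
    ordered 0F 2F _ = a<c
    ordered 1F 0F _ = b<a
    ordered 1F 2F _ = <-trans b<a a<c
    ordered 0F 0F (s≤s ())
    ordered 0F 1F ()
    ordered 1F 1F ()
    ordered 2F 0F (s≤s ())
    ordered 2F 1F ()
    ordered 2F 2F (s≤s (s≤s ()))

  contains321-intro : (t : Triple σ V) → let open Triple t in
    row σ b < row σ a → row σ c < row σ b → ContainsIn p321 σ V
  contains321-intro t b<a c<b = contains-intro p321 p321-injective t ordered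
    where
    open Triple t
    ordered : ∀ p q → lookup p321 p Fin.< lookup p321 q → row σ (column p) < row σ (column q)
    ordered 1F 0F _ = b<a
    ordered 2F 1F _ = c<b
    ordered 2F 0F _ = <-trans c<b b<a
    ordered 0F 0F (s≤s (s≤s ()))
    ordered 0F 1F (s≤s ())
    ordered 0F 2F ()
    ordered 1F 1F (s≤s ())
    ordered 1F 2F ()
    ordered 2F 2F ()

  containsIn-triple : (τ : Vec (Fin 3) 3) → ContainsIn τ σ V → Triple σ V
  containsIn-triple τ (col , increasing , inΓ , _) =
    triple (col 0F) (col 1F) (col 2F) (increasing 0F 1F (s≤s z≤n)) (increasing 1F 2F (s≤s (s≤s z≤n)))
      (inΓ 0F) (inΓ 1F) (inΓ 2F)

  contains213-elim : ContainsIn p213 σ V →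
    Σ (Triple σ V) λ t → let open Triple t in row σ b < row σ a × row σ a < row σ c
  contains213-elim occ@(_ , _ , _ , ordered) =
    containsIn-triple p213 occ , proj₁ (ordered 1F 0F) (s≤s z≤n) , proj₁ (ordered 0F 2F) (s≤s (s≤s z≤n))

  contains321-elim : ContainsIn p321 σ V →
    Σ (Triple σ V) λ t → let open Triple t in row σ b < row σ a × row σ c < row σ b
  contains321-elim occ@(_ , _ , _ , ordered) =
    containsIn-triple p321 occ , proj₁ (ordered 1F 0F) (s≤s (s≤s z≤n)) , proj₁ (ordered 2F 1F) (s≤s z≤n)

-- Suffix maxima and the border of F_R

sufMax : ∀ {n m} → Vec (Fin n) m → ℕ → ℕ
sufMax []       i       = 0
sufMax (x ∷ xs) zero    = suc (toℕ x) ⊔ sufMax xs zero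
sufMax (x ∷ xs) (suc i) = sufMax xs i

sufMax-beyond : ∀ {n m} (xs : Vec (Fin n) m) {i} → m ≤ i → sufMax xs i ≡ 0
sufMax-beyond []       _         = refl
sufMax-beyond (x ∷ xs) (s≤s m≤i) = sufMax-beyond xs m≤i

sufMax-> : ∀ {n m} (xs : Vec (Fin n) m) k {i} → i ≤ toℕ k → toℕ (lookup xs k) < sufMax xs i
sufMax-> (x ∷ xs) Fin.zero    {zero}  _         = m≤m⊔n (suc (toℕ x)) (sufMax xs zero)
sufMax-> (x ∷ xs) (Fin.suc k) {zero}  _         = ≤-trans (sufMax-> xs k z≤n) (m≤n⊔m (suc (toℕ x)) _)
sufMax-> (x ∷ xs) (Fin.suc k) {suc i} (s≤s i≤k) = sufMax-> xs k i≤k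

sufMax-attained : ∀ {n m} (xs : Vec (Fin n) m) {i} → i < m →
  ∃ λ k → i ≤ toℕ k × suc (toℕ (lookup xs k)) ≡ sufMax xs i
sufMax-attained (x ∷ []) {zero} _ = Fin.zero , z≤n , sym (⊔-identityʳ _)
sufMax-attained (x ∷ y ∷ ys) {zero} _
  with sufMax-attained (y ∷ ys) z<s | ≤-total (suc (toℕ x)) (sufMax (y ∷ ys) zero)
... | k , _ , top | inj₁ x≤ys = Fin.suc k , z≤n , trans top (sym (m≤n⇒m⊔n≡n x≤ys))
... | _           | inj₂ ys≤x = Fin.zero , z≤n , sym (m≥n⇒m⊔n≡m ys≤x)
sufMax-attained (x ∷ xs) {suc i} (s≤s i<m) with sufMax-attained xs i<m
... | k , i≤k , top = Fin.suc k , s≤s i≤k , top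

sufMax-step : ∀ {n m} (xs : Vec (Fin n) m) k →
  sufMax xs (toℕ k) ≡ suc (toℕ (lookup xs k)) ⊔ sufMax xs (suc (toℕ k))
sufMax-step (x ∷ xs) Fin.zero    = refl
sufMax-step (x ∷ xs) (Fin.suc k) = sufMax-step xs k

sufMax-least : ∀ {n m} (xs : Vec (Fin n) m) {h} → (∀ k → toℕ (lookup xs k) < h (toℕ k)) →
  Antitone h → ∀ i → sufMax xs i ≤ h i
sufMax-least []       below anti i = z≤n
sufMax-least (x ∷ xs) {h} below anti zero =
  ⊔-lub (below Fin.zero) (≤-trans (sufMax-least xs {h ∘ suc} (below ∘ Fin.suc) (anti ∘ suc) 0) (anti 0))
sufMax-least (x ∷ xs) {h} below anti (suc i) = sufMax-least xs {h ∘ suc} (below ∘ Fin.suc) (anti ∘ suc) i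

sufMax-antitone : ∀ {n m} (xs : Vec (Fin n) m) → Antitone (sufMax xs)
sufMax-antitone []       i       = z≤n
sufMax-antitone (x ∷ xs) zero    = m≤n⊔m (suc (toℕ x)) (sufMax xs zero)
sufMax-antitone (x ∷ xs) (suc i) = sufMax-antitone xs i

sufMax-≤ : ∀ {n m} (xs : Vec (Fin n) m) i → sufMax xs i ≤ n
sufMax-≤ xs = sufMax-least xs (λ k → Finₚ.toℕ<n (lookup xs k)) (λ _ → ≤-refl)

-- pigeonhole: the n ∸ i columns ≥ i carry distinct rows below sufMax σ i
sufMax-lower : ∀ {n} (σ : Vec (Fin n) n) → DistinctRows σ →
  ∀ {i} → i < n → n ≤ sufMax σ i + i
sufMax-lower {n} σ inj {i} i<n = begin
  n                ≡⟨ sym (m∸n+n≡m (<⇒≤ i<n)) ⟩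
  n ∸ i + i        ≤⟨ +-monoˡ-≤ i (Finₚ.injective⇒≤ {f = rowOf} rowOf-injective) ⟩
  sufMax σ i + i   ∎
  where
  open ≤-Reasoning
  column : Fin (n ∸ i) → Fin n
  column t = fromℕ< (subst (i + toℕ t <_) (m+[n∸m]≡n (<⇒≤ i<n)) (+-monoʳ-< i (Finₚ.toℕ<n t)))
  toℕ-column : ∀ t → toℕ (column t) ≡ i + toℕ t
  toℕ-column t = Finₚ.toℕ-fromℕ< _
  rowOf : Fin (n ∸ i) → Fin (sufMax σ i)
  rowOf t = fromℕ< (sufMax-> σ (column t) (subst (i ≤_) (sym (toℕ-column t)) (m≤m+n i (toℕ t))))
  rowOf-injective : ∀ {t u} → rowOf t ≡ rowOf u → t ≡ u
  rowOf-injective {t} {u} eq = Finₚ.toℕ-injective (+-cancelˡ-≡ i _ _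
    (trans (sym (toℕ-column t)) (trans (cong toℕ same-column) (toℕ-column u))))
    where
    same-column : column t ≡ column u
    same-column = inj _ _ (Finₚ.toℕ-injective (Finₚ.fromℕ<-injective _ _ _ _ eq))

sufMax-admissible : ∀ {n} (σ : Vec (Fin n) n) → DistinctRows σ →
  Admissible n (sufMax σ)
sufMax-admissible σ inj = record { antitone = sufMax-antitone σ ; reaches-diagonal = sufMax-lower σ inj }

minBoard : ∀ n → Vec (Fin n) n → List Step
minBoard n σ = heightsPath n n (sufMax σ)

minBoard-dyck : ∀ {n} (σ : Vec (Fin n) n) → DistinctRows σ →
  IsDyck n (minBoard n σ)
minBoard-dyck σ inj = heightsPath-dyck (sufMax-admissible σ inj) (sufMax-≤ σ 0)

minBoard-colH : ∀ n (σ : Vec (Fin n) n) i → colH n (minBoard n σ) i ≡ sufMax σ i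
minBoard-colH n σ i with i <? n
... | yes i<n = colHFrom-heightsPath n n (sufMax σ) (sufMax-antitone σ) (sufMax-≤ σ 0) i<n
... | no  i≮n = trans (colHFrom-beyond n (minBoard n σ) (subst (_≤ i) (sym (#E-heightsPath n n _)) (≮⇒≥ i≮n)))
                      (sym (sufMax-beyond σ (≮⇒≥ i≮n)))

InBoard-⊆⇒colH-≤ : ∀ {n D D′ i} → (∀ j → InBoard n D i j → InBoard n D′ i j) → colH n D i ≤ colH n D′ i
InBoard-⊆⇒colH-≤ {n} {D} {D′} {i} ⊆ = go (colH n D i) ⊆
  where
  go : ∀ a → (∀ j → j < a → j < colH n D′ i) → a ≤ colH n D′ i
  go zero    _     = z≤n
  go (suc a) below = below a ≤-refl

border-intro : ∀ {n} D0 (σ : Vec (Fin n) n) → IsDyck n D0 →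
  (∀ i → row σ i < colH n D0 (toℕ i)) →
  (∀ {i} → i < n → ∃ λ k → i ≤ toℕ k × suc (row σ k) ≡ colH n D0 i) →
  IsBorderOfFR n σ D0
border-intro {n} D0 σ dy0 inside attained = dy0 , inside , minimal
  where
  minimal : ∀ D → IsDyck n D → (∀ i → InBoard n D (toℕ i) (row σ i)) →
    ∀ i j → InBoard n D0 i j → InBoard n D i j
  minimal D _ insideD i j j<h0 with i <? n
  ... | no  i≮n = contradiction (subst (j <_) (dyck-colH-beyond {D = D0} {i} dy0 (≮⇒≥ i≮n)) j<h0) n≮0
  ... | yes i<n = let k , i≤k , top = attained i<n in begin-strict
    j                 ≤⟨ ≤-pred (subst (j <_) (sym top) j<h0) ⟩
    row σ k           <⟨ insideD k ⟩
    colH n D (toℕ k)  ≤⟨ antitone-≤ (colHFrom-antitone n D) i≤k ⟩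
    colH n D i        ∎
    where open ≤-Reasoning

minBoard-border : ∀ {n} (σ : Vec (Fin n) n) → DistinctRows σ →
  IsBorderOfFR n σ (minBoard n σ)
minBoard-border {n} σ inj = border-intro (minBoard n σ) σ (minBoard-dyck σ inj) inside attained
  where
  inside : ∀ i → row σ i < colH n (minBoard n σ) (toℕ i)
  inside i = subst (row σ i <_) (sym (minBoard-colH n σ (toℕ i))) (sufMax-> σ i ≤-refl)
  attained : ∀ {i} → i < n → ∃ λ k → i ≤ toℕ k × suc (row σ k) ≡ colH n (minBoard n σ) i
  attained {i} i<n = let k , i≤k , top = sufMax-attained σ i<n in
    k , i≤k , trans top (sym (minBoard-colH n σ i))

border-colH : ∀ {n D0} (σ : Vec (Fin n) n) → DistinctRows σ →
  IsBorderOfFR n σ D0 → ∀ i → colH n D0 i ≡ sufMax σ i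
border-colH {n} {D0} σ inj (_ , inside , minimal) i = ≤-antisym
  (subst (colH n D0 i ≤_) (minBoard-colH n σ i) (InBoard-⊆⇒colH-≤ {n} {D0} {minBoard n σ}
    (minimal (minBoard n σ) (minBoard-dyck σ inj) (proj₁ (proj₂ (minBoard-border σ inj))) i)))
  (sufMax-least σ inside (colHFrom-antitone n D0) i)

rows-onto : ∀ {n} (σ : Vec (Fin n) n) → DistinctRows σ →
  ∀ {r} → r < n → ∃ λ c → row σ c ≡ r
rows-onto σ inj r<n with injective⇒surjective (lookup σ) inj (fromℕ< r<n)
... | c , σc≡r = c , trans (cong toℕ σc≡r) (Finₚ.toℕ-fromℕ< r<n)

-- If the suffix maxima drop right after column I, the rook of I realises the
-- maximum, the rook one row higher lies to its left and the next rook lies below.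
sufMax-drop⇒321 : ∀ {n} (σ : Vec (Fin n) n) → DistinctRows σ →
  ∀ I → sufMax σ (suc (toℕ I)) < sufMax σ (toℕ I) →
  ∀ {x y} → suc (toℕ I) < x → sufMax σ (toℕ I) < y → x ≤ n → y ≤ n → ContainsIn p321 σ (x , y)
sufMax-drop⇒321 {n} σ inj I drop {x} {y} I+1<x top<y x≤n y≤n =
  contains321-intro {σ = σ} (triple C I J C<I I<J (C<x , C<y) (I<x , I<y) (J<x , J<y)) I<ᵣC J<ᵣI
  where
  top : sufMax σ (toℕ I) ≡ suc (row σ I)
  top with ⊔-sel (suc (row σ I)) (sufMax σ (suc (toℕ I)))
  ... | inj₁ ⊔≡row = trans (sufMax-step σ I) ⊔≡row
  ... | inj₂ ⊔≡next = contradiction (trans (sufMax-step σ I) ⊔≡next) (<⇒≢ drop ∘ sym)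
  J : Fin n
  J = fromℕ< (<-≤-trans I+1<x x≤n)
  toℕ-J : toℕ J ≡ suc (toℕ I)
  toℕ-J = Finₚ.toℕ-fromℕ< _
  C : Fin n
  C = proj₁ (rows-onto σ inj (<-≤-trans top<y y≤n))
  row-C : row σ C ≡ sufMax σ (toℕ I)
  row-C = proj₂ (rows-onto σ inj (<-≤-trans top<y y≤n))
  C<I : C Fin.< I
  C<I = ≰⇒> (λ I≤C → <-irrefl row-C (sufMax-> σ C I≤C))
  I<J : I Fin.< J
  I<J = subst (toℕ I <_) (sym toℕ-J) (n<1+n (toℕ I))
  I<ᵣC : row σ I < row σ C
  I<ᵣC = subst (row σ I <_) (sym (trans row-C top)) (n<1+n (row σ I))
  J<ᵣI : row σ J < row σ I
  J<ᵣI = <-≤-trans (sufMax-> σ J (≤-reflexive (sym toℕ-J))) (≤-pred (subst (sufMax σ (suc (toℕ I)) <_) top drop))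
  J<x : toℕ J < x
  J<x = subst (_< x) (sym toℕ-J) I+1<x
  I<x : toℕ I < x
  I<x = <-trans I<J J<x
  C<x : toℕ C < x
  C<x = <-trans C<I I<x
  C<y : row σ C < y
  C<y = subst (_< y) (sym row-C) top<y
  I<y : row σ I < y
  I<y = <-trans I<ᵣC C<y
  J<y : row σ J < y
  J<y = <-trans J<ᵣI I<y

minBoard-peak⇒321 : ∀ {n} (σ : Vec (Fin n) n) → DistinctRows σ →
  ∀ {P x y} → P ∈ peaks n (minBoard n σ) → proj₁ P < x → proj₂ P < y → x ≤ n → y ≤ n →
  ContainsIn p321 σ (x , y)
minBoard-peak⇒321 {n} σ inj {y = y} P∈ Px<x Py<y x≤n y≤n with peaksFrom-descent 0 n (minBoard n σ) P∈
... | i , refl , _ , descent with toℕ-onto {i} {n} (<-trans (n<1+n i) (<-≤-trans Px<x x≤n))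
...   | I , refl = sufMax-drop⇒321 σ inj I (drop descent) Px<x
                     (subst (_< y) (minBoard-colH n σ (toℕ I)) Py<y) x≤n y≤n
  where
  colH-sufMax : ∀ j → colH n (minBoard n σ) j ≡ sufMax σ j
  colH-sufMax = minBoard-colH n σ
  drop : colH n (minBoard n σ) (suc (toℕ I)) < colH n (minBoard n σ) (toℕ I) ⊎ colH n (minBoard n σ) (toℕ I) ≡ 0 →
    sufMax σ (suc (toℕ I)) < sufMax σ (toℕ I)
  drop (inj₁ colH-drop) = subst₂ _<_ (colH-sufMax _) (colH-sufMax _) colH-drop
  drop (inj₂ colH≡0)    =
    contradiction (subst (row σ I <_) (trans (sym (colH-sufMax _)) colH≡0) (sufMax-> σ I ≤-refl)) n≮0

-- Greedy placements

-- rooks placed from right to left, each as high as its column allows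
Greedy : ∀ {n} → (ℕ → ℕ) → Vec (Fin n) n → Set
Greedy h σ = ∀ {c i} → c Fin.< i → row σ c < h (toℕ i) → row σ c < row σ i

record GreedyPlacement {n} (h : ℕ → ℕ) (σ : Vec (Fin n) n) : Set where
  field
    injective : DistinctRows σ
    below     : ∀ i → row σ i < h (toℕ i)
    greedy    : Greedy h σ

greedyPlacement-unique : ∀ {n h} {σ σ′ : Vec (Fin n) n} →
  GreedyPlacement h σ → GreedyPlacement h σ′ → σ ≡ σ′
greedyPlacement-unique {n} {h} {σ} {σ′} P P′ = begin
  σ                     ≡⟨ sym (tabulate∘lookup σ) ⟩
  tabulate (lookup σ)   ≡⟨ tabulate-cong (λ i → agree i (>-wellFounded i)) ⟩
  tabulate (lookup σ′)  ≡⟨ tabulate∘lookup σ′ ⟩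
  σ′                    ∎
  where
  open ≡-Reasoning
  -- The rook of τ′ in row τ i can be neither right of i (the placements agree
  -- there) nor left of i (it would lie below τ′ i by greediness).
  ≤-if-agree-right : ∀ {τ τ′} → GreedyPlacement h τ → GreedyPlacement h τ′ → ∀ i →
    (∀ {j} → i Fin.< j → lookup τ j ≡ lookup τ′ j) → row τ i ≤ row τ′ i
  ≤-if-agree-right {τ} {τ′} Q Q′ i agree-right with row τ i ≤? row τ′ i
  ... | yes τi≤τ′i = τi≤τ′i
  ... | no  τi≰τ′i with injective⇒surjective (lookup τ′) (GreedyPlacement.injective Q′) (lookup τ i)
  ...   | c , τ′c≡τi with Finₚ.<-cmp c i
  ...     | tri≈ _ refl _ = contradiction (≤-reflexive (cong toℕ (sym τ′c≡τi))) τi≰τ′i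
  ...     | tri> _ _ i<c  = contradiction
              (GreedyPlacement.injective Q c i (trans (agree-right i<c) τ′c≡τi)) (Finₚ.<⇒≢ i<c ∘ sym)
  ...     | tri< c<i _ _  = contradiction (<⇒≤ (subst (_< row τ′ i) τ′c≡ᵣτi
              (GreedyPlacement.greedy Q′ c<i (subst (_< h (toℕ i)) (sym τ′c≡ᵣτi) (GreedyPlacement.below Q i)))))
              τi≰τ′i
    where
    τ′c≡ᵣτi : row τ′ c ≡ row τ i
    τ′c≡ᵣτi = cong toℕ τ′c≡τi
  agree : ∀ i → Acc Fin._>_ i → lookup σ i ≡ lookup σ′ i
  agree i (acc rec) = Finₚ.toℕ-injective (≤-antisym
    (≤-if-agree-right P P′ i right) (≤-if-agree-right P′ P i (λ i<j → sym (right i<j))))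
    where
    right : ∀ {j} → i Fin.< j → lookup σ j ≡ lookup σ′ j
    right i<j = agree _ (rec i<j)

greedy⇒avoids213 : ∀ {n h} {σ : Vec (Fin n) n} → GreedyPlacement h σ → Antitone h →
  ∀ V → ¬ ContainsIn p213 σ V
greedy⇒avoids213 {h = h} {σ} P anti V occ with contains213-elim {σ = σ} occ
... | triple a b c a<b b<c _ _ _ , b<ᵣa , a<ᵣc =
  <-asym b<ᵣa (greedy a<b (<-trans a<ᵣc (<-≤-trans (below c) (antitone-≤ anti (<⇒≤ b<c)))))
  where open GreedyPlacement P

-- Columns b and c of the 321 are too low for the rooks to their left, so the
-- column heights drop somewhere between b and c: that descent is the peak.
greedy321⇒peak : ∀ {n D0} {σ : Vec (Fin n) n} → IsDyck n D0 → GreedyPlacement (colH n D0) σ →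
  ∀ x y → ContainsIn p321 σ (x , y) → ∃ λ P → P ∈ peaks n D0 × proj₁ P < x × proj₂ P < y
greedy321⇒peak {n} {D0} {σ} dy0 P x y occ with contains321-elim {σ = σ} occ
... | triple a b c a<b b<c a∈Γ _ c∈Γ , b<ᵣa , c<ᵣb =
  peakAt (antitone-descent (colHFrom-antitone n D0) (≤⇒≤′ (<⇒≤ b<c)) hc<hb)
  where
  open GreedyPlacement P
  h : ℕ → ℕ
  h = colH n D0
  hb≤a : h (toℕ b) ≤ row σ a
  hb≤a = ≮⇒≥ (λ a<hb → <-asym b<ᵣa (greedy a<b a<hb))
  hc<hb : h (toℕ c) < h (toℕ b)
  hc<hb = ≤-<-trans (≮⇒≥ (λ b<hc → <-asym c<ᵣb (greedy b<c b<hc))) (below b)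
  peakAt : (∃ λ k → toℕ b ≤ k × k < toℕ c × h (suc k) < h k × h k ≡ h (toℕ b)) →
    ∃ λ P → P ∈ peaks n D0 × proj₁ P < x × proj₂ P < y
  peakAt (k , _ , k<c , drop , hk≡hb) =
    (suc k , h k) ,
    peaksFrom-intro 0 n D0 k (subst (suc k <_) (sym (proj₁ dy0)) (≤-<-trans k<c (Finₚ.toℕ<n c))) drop ,
    ≤-<-trans k<c (proj₁ c∈Γ) ,
    subst (_< y) (sym hk≡hb) (≤-<-trans hb≤a (proj₂ a∈Γ))

avoids213⇒greedy : ∀ {n DF D0} {σ : Vec (Fin n) n} → IsDyck n DF → R213 n DF σ →
  IsBorderOfFR n σ D0 → Greedy (colH n D0) σ
avoids213⇒greedy {n} {DF} {D0} {σ} dyF ((inj , inF) , avoids) border {c} {i} c<i c<hi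
  with <-cmp (row σ c) (row σ i)
... | tri< c<ᵣi _ _ = c<ᵣi
... | tri≈ _ c≡ᵣi _ = contradiction (inj c i (Finₚ.toℕ-injective c≡ᵣi)) (Finₚ.<⇒≢ c<i)
... | tri> _ _ i<ᵣc =
  let k , i≤k , top = sufMax-attained σ (Finₚ.toℕ<n i) in
  ⊥-elim (no213 k i≤k (subst (row σ c <_) (trans (border-colH {D0 = D0} σ inj border (toℕ i)) (sym top)) c<hi))
  where
  -- k is the rook realising the height of column i
  no213 : ∀ k → toℕ i ≤ toℕ k → row σ c < suc (row σ k) → ⊥
  no213 k i≤k c<top with m≤n⇒m<n∨m≡n i≤k
  ... | inj₂ i≡k = <⇒≱ i<ᵣc (subst (row σ c ≤_) (cong (row σ) (Finₚ.toℕ-injective (sym i≡k))) (≤-pred c<top))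
  ... | inj₁ i<k = avoids (suc (toℕ k) , colH n DF (toℕ k))
      (vertsFrom-corner 0 n DF (toℕ k) (subst (toℕ k <_) (sym (proj₁ dyF)) (Finₚ.toℕ<n k)))
      (contains213-intro {σ = σ}
        (triple c i k c<i i<k
          (s≤s (<⇒≤ (<-trans c<i i<k)) , <-trans c<ᵣk (inF k))
          (s≤s (<⇒≤ i<k) , <-trans i<ᵣc (<-trans c<ᵣk (inF k)))
          (n<1+n (toℕ k) , inF k))
        i<ᵣc c<ᵣk)
    where
    c<ᵣk : row σ c < row σ k
    c<ᵣk = ≤∧≢⇒< (≤-pred c<top)
      (λ c≡ᵣk → Finₚ.<⇒≢ (<-trans c<i i<k) (inj c k (Finₚ.toℕ-injective c≡ᵣk)))

-- The greedy placement under a Dyck path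

-- the position of row x after a new row is inserted at r (as Fin.punchIn)
punchIn : ℕ → ℕ → ℕ
punchIn zero    x       = suc x
punchIn (suc r) zero    = zero
punchIn (suc r) (suc x) = suc (punchIn r x)

punchIn-≤ : ∀ r x → punchIn r x ≤ suc x
punchIn-≤ zero    x       = ≤-refl
punchIn-≤ (suc r) zero    = z≤n
punchIn-≤ (suc r) (suc x) = s≤s (punchIn-≤ r x)

punchIn-≥ : ∀ {r x} → r ≤ x → punchIn r x ≡ suc x
punchIn-≥ {zero}          _         = refl
punchIn-≥ {suc r} {suc x} (s≤s r≤x) = cong suc (punchIn-≥ r≤x)

punchInᵣ≢r : ∀ r x → punchIn r x ≢ r
punchInᵣ≢r zero    x       ()
punchInᵣ≢r (suc r) zero    ()
punchInᵣ≢r (suc r) (suc x) eq = punchInᵣ≢r r x (suc-injective eq)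

punchIn-injective : ∀ r {x y} → punchIn r x ≡ punchIn r y → x ≡ y
punchIn-injective zero                    eq = suc-injective eq
punchIn-injective (suc r) {zero}  {zero}  _  = refl
punchIn-injective (suc r) {suc x} {suc y} eq = cong suc (punchIn-injective r (suc-injective eq))
punchIn-injective (suc r) {zero}  {suc y} ()
punchIn-injective (suc r) {suc x} {zero}  ()

punchIn-mono-< : ∀ r {x y} → x < y → punchIn r x < punchIn r y
punchIn-mono-< zero                    x<y       = s≤s x<y
punchIn-mono-< (suc r) {zero}  {suc y} _         = z<s
punchIn-mono-< (suc r) {suc x} {suc y} (s≤s x<y) = s≤s (punchIn-mono-< r x<y)

-- The last column m takes the highest row pred (h m) it can; deleting that row
-- leaves the heights pred ∘ h for the remaining columns.
fill : ℕ → (ℕ → ℕ) → ℕ → ℕ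
fill zero    h i = 0
fill (suc m) h i with i ≟ m
... | yes _ = pred (h m)
... | no  _ = punchIn (pred (h m)) (fill m (pred ∘ h) i)

fill-last : ∀ m h → fill (suc m) h m ≡ pred (h m)
fill-last m h with m ≟ m
... | yes _   = refl
... | no  m≢m = contradiction refl m≢m

fill-init : ∀ m h {i} → i ≢ m → fill (suc m) h i ≡ punchIn (pred (h m)) (fill m (pred ∘ h) i)
fill-init m h {i} i≢m with i ≟ m
... | yes i≡m = contradiction i≡m i≢m
... | no  _   = refl

admissible-positive : ∀ {n h} → Admissible n h → ∀ {i} → i < n → 0 < h i
admissible-positive {n} {h} adm {i} i<n with h i | Admissible.reaches-diagonal adm i<n
... | zero  | n≤i = contradiction (<-≤-trans i<n n≤i) (<-irrefl refl)
... | suc _ | _   = z<s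

admissible-pred : ∀ {m h} → Admissible (suc m) h → Admissible m (pred ∘ h)
admissible-pred {m} {h} adm = record
  { antitone         = λ i → pred-mono-≤ (antitone i)
  ; reaches-diagonal = λ {i} i<m → lower (h i) (reaches-diagonal (m<n⇒m<1+n i<m))
  }
  where
  open Admissible adm
  lower : ∀ a {i} → suc m ≤ a + i → m ≤ pred a + i
  lower zero    le       = ≤-trans (n≤1+n m) le
  lower (suc a) (s≤s le) = le

fill-< : ∀ {n h} → Admissible n h → ∀ {i} → i < n → fill n h i < h i
fill-< {suc m} {h} adm {i} i<n with i ≟ m
... | yes refl = pred-< (admissible-positive adm i<n)
... | no  i≢m  = begin-strict
  punchIn (pred (h m)) (fill m (pred ∘ h) i)  ≤⟨ punchIn-≤ _ _ ⟩
  suc (fill m (pred ∘ h) i)                  ≤⟨ fill-< (admissible-pred adm) (≤∧≢⇒< (≤-pred i<n) i≢m) ⟩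
  pred (h i)                                 <⟨ pred-< (admissible-positive adm i<n) ⟩
  h i                                        ∎
  where open ≤-Reasoning

fill-injective : ∀ {n} h {i j} → i < n → j < n → fill n h i ≡ fill n h j → i ≡ j
fill-injective {suc m} h {i} {j} i<n j<n eq with i ≟ m | j ≟ m
... | yes i≡m | yes j≡m = trans i≡m (sym j≡m)
... | yes _   | no  _   = contradiction (sym eq) (punchInᵣ≢r _ _)
... | no  _   | yes _   = contradiction eq (punchInᵣ≢r _ _)
... | no  i≢m | no  j≢m = fill-injective (pred ∘ h) (≤∧≢⇒< (≤-pred i<n) i≢m) (≤∧≢⇒< (≤-pred j<n) j≢m)
                            (punchIn-injective _ eq)

fill-greedy : ∀ {n h} → Admissible n h → ∀ {c i} → c < i → i < n → fill n h c < h i →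
  fill n h c < fill n h i
fill-greedy {suc m} {h} adm {c} {i} c<i i<n fc<hi with m≤n⇒m<n∨m≡n (≤-pred i<n)
fill-greedy {suc m} {h} adm {c} {.m} c<m _ fc<hm | inj₂ refl = begin-strict
  fill (suc m) h c                            ≡⟨ fill-init m h c≢m ⟩
  punchIn (pred (h m)) (fill m (pred ∘ h) c)  <⟨ ≤∧≢⇒< (≤-pred below-top) (punchInᵣ≢r _ _) ⟩
  pred (h m)                                  ≡⟨ sym (fill-last m h) ⟩
  fill (suc m) h m                            ∎
  where
  open ≤-Reasoning
  c≢m : c ≢ m
  c≢m = <⇒≢ c<m
  below-top : punchIn (pred (h m)) (fill m (pred ∘ h) c) < suc (pred (h m))
  below-top = subst₂ _<_ (fill-init m h c≢m) (sym (suc-pred-> (admissible-positive adm (n<1+n m)))) fc<hm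
fill-greedy {suc m} {h} adm {c} {i} c<i i<n fc<hi | inj₁ i<m = begin-strict
  fill (suc m) h c                            ≡⟨ fill-init m h c≢m ⟩
  punchIn (pred (h m)) (fill m (pred ∘ h) c)  <⟨ punchIn-mono-< _ (fill-greedy (admissible-pred adm) c<i i<m fc<pred-hi) ⟩
  punchIn (pred (h m)) (fill m (pred ∘ h) i)  ≡⟨ sym (fill-init m h (<⇒≢ i<m)) ⟩
  fill (suc m) h i                            ∎
  where
  open ≤-Reasoning
  c≢m : c ≢ m
  c≢m = <⇒≢ (<-trans c<i i<m)
  fc<pred-hi : fill m (pred ∘ h) c < pred (h i)
  fc<pred-hi with pred (h m) ≤? fill m (pred ∘ h) c
  ... | yes hm≤fc = <⇒≤pred (subst (_< h i) (trans (fill-init m h c≢m) (punchIn-≥ hm≤fc)) fc<hi)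
  ... | no  hm≰fc = <-≤-trans (≰⇒> hm≰fc) (pred-mono-≤ (antitone-≤ (Admissible.antitone adm) (<⇒≤ i<m)))

fill-attains : ∀ {n h} → Admissible n h → ∀ {i} → i < n →
  ∃ λ k → i ≤ k × k < n × suc (fill n h k) ≡ h i
fill-attains {suc m} {h} adm {i} i<n with m≤n⇒m<n∨m≡n (≤-pred i<n)
fill-attains {suc m} {h} adm {.m} i<n | inj₂ refl =
  m , ≤-refl , n<1+n m , trans (cong suc (fill-last m h)) (suc-pred-> (admissible-positive adm i<n))
fill-attains {suc m} {h} adm {i} i<n | inj₁ i<m
  with fill-attains (admissible-pred adm) i<m | m≤n⇒m<n∨m≡n (antitone-≤ (Admissible.antitone adm) (<⇒≤ i<m))
... | _ , _ , _ , _ | inj₂ hm≡hi =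
  m , <⇒≤ i<m , n<1+n m ,
  trans (cong suc (fill-last m h)) (trans (suc-pred-> (admissible-positive adm (n<1+n m))) hm≡hi)
... | k , i≤k , k<m , top | inj₁ hm<hi = k , i≤k , m<n⇒m<1+n k<m , (begin
  suc (fill (suc m) h k)                            ≡⟨ cong suc (fill-init m h (<⇒≢ k<m)) ⟩
  suc (punchIn (pred (h m)) (fill m (pred ∘ h) k))  ≡⟨ cong suc (punchIn-≥ hm≤fk) ⟩
  suc (suc (fill m (pred ∘ h) k))                   ≡⟨ cong suc top ⟩
  suc (pred (h i))                                  ≡⟨ hi≡ ⟩
  h i                                               ∎)
  where
  open ≡-Reasoning
  hi≡ : suc (pred (h i)) ≡ h i
  hi≡ = suc-pred-> (admissible-positive adm i<n)
  hm≤fk : pred (h m) ≤ fill m (pred ∘ h) k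
  hm≤fk = pred-mono-≤ (≤-pred (subst (h m <_) (trans (sym hi≡) (cong suc (sym top))) hm<hi))

fillPlacement : ∀ {n} D0 → IsDyck n D0 → Vec (Fin n) n
fillPlacement {n} D0 dy0 = tabulate λ i →
  fromℕ< (<-≤-trans (fill-< (dyck-admissible {D = D0} dy0) (Finₚ.toℕ<n i)) (colHFrom-≤ n D0 (toℕ i)))

row-fillPlacement : ∀ {n} D0 (dy0 : IsDyck n D0) i →
  row (fillPlacement D0 dy0) i ≡ fill n (colH n D0) (toℕ i)
row-fillPlacement D0 dy0 i = trans (cong toℕ (lookup∘tabulate _ i)) (Finₚ.toℕ-fromℕ< _)

fillPlacement-greedy : ∀ {n} D0 (dy0 : IsDyck n D0) → GreedyPlacement (colH n D0) (fillPlacement D0 dy0)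
fillPlacement-greedy {n} D0 dy0 = record { injective = injective ; below = below ; greedy = greedy }
  where
  adm : Admissible n (colH n D0)
  adm = dyck-admissible {D = D0} dy0
  rowσ : ∀ i → row (fillPlacement D0 dy0) i ≡ fill n (colH n D0) (toℕ i)
  rowσ = row-fillPlacement D0 dy0
  injective : DistinctRows (fillPlacement D0 dy0)
  injective i j σi≡σj = Finₚ.toℕ-injective (fill-injective (colH n D0) (Finₚ.toℕ<n i) (Finₚ.toℕ<n j)
    (trans (sym (rowσ i)) (trans (cong toℕ σi≡σj) (rowσ j))))
  below : ∀ i → row (fillPlacement D0 dy0) i < colH n D0 (toℕ i)
  below i = subst (_< colH n D0 (toℕ i)) (sym (rowσ i)) (fill-< adm (Finₚ.toℕ<n i))
  greedy : Greedy (colH n D0) (fillPlacement D0 dy0)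
  greedy {c} {i} c<i c<hi = subst₂ _<_ (sym (rowσ c)) (sym (rowσ i))
    (fill-greedy adm c<i (Finₚ.toℕ<n i) (subst (_< colH n D0 (toℕ i)) (rowσ c) c<hi))

fillPlacement-border : ∀ {n} D0 (dy0 : IsDyck n D0) → IsBorderOfFR n (fillPlacement D0 dy0) D0
fillPlacement-border {n} D0 dy0 =
  border-intro D0 (fillPlacement D0 dy0) dy0 (GreedyPlacement.below (fillPlacement-greedy D0 dy0)) attained
  where
  attained : ∀ {i} → i < n → ∃ λ K → i ≤ toℕ K × suc (row (fillPlacement D0 dy0) K) ≡ colH n D0 i
  attained i<n with fill-attains (dyck-admissible {D = D0} dy0) i<n
  ... | k , i≤k , k<n , top with toℕ-onto k<n
  ...   | K , refl = K , i≤k , trans (cong suc (row-fillPlacement D0 dy0 K)) top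

minBoard-inA2 : ∀ {n DF} {σ : Vec (Fin n) n} → IsDyck n DF → R213-321 n DF σ → InA2 n (minBoard n σ) DF
minBoard-inA2 {n} {DF} {σ} dyF ((inj , inF) , _ , avoids321) = (minBoard-dyck σ inj , underDF) , noPeak
  where
  underDF : ∀ i → colH n (minBoard n σ) i ≤ colH n DF i
  underDF i = subst (_≤ colH n DF i) (sym (minBoard-colH n σ i)) (sufMax-least σ inF (colHFrom-antitone n DF) i)
  noPeak : ∀ V → V ∈ verts n DF → ∀ P → P ∈ peaks n (minBoard n σ) → ¬ (proj₁ P < proj₁ V × proj₂ P < proj₂ V)
  noPeak (x , y) V∈ P P∈ (Px<x , Py<y) =
    let x≤#E , y≤n = vertsFrom-bounded 0 n DF V∈ in
    avoids321 (x , y) V∈ (minBoard-peak⇒321 σ inj P∈ Px<x Py<y (subst (x ≤_) (proj₁ dyF) x≤#E) y≤n)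

border213-unique : ∀ {n DF D0} {σ σ′ : Vec (Fin n) n} → IsDyck n DF → R213 n DF σ → R213 n DF σ′ →
  IsBorderOfFR n σ D0 → IsBorderOfFR n σ′ D0 → σ ≡ σ′
border213-unique {n} {DF} {D0} dyF R R′ B B′ = greedyPlacement-unique (placement R B) (placement R′ B′)
  where
  placement : ∀ {σ} → R213 n DF σ → IsBorderOfFR n σ D0 → GreedyPlacement (colH n D0) σ
  placement {σ} R@((inj , _) , _) B@(_ , inside , _) =
    record { injective = inj ; below = inside ; greedy = avoids213⇒greedy {DF = DF} {D0} {σ} dyF R B }

fillPlacement-avoids : ∀ {n DF D0} (A : InA2 n D0 DF) → R213-321 n DF (fillPlacement D0 (proj₁ (proj₁ A)))
fillPlacement-avoids {n} {DF} {D0} ((dy0 , underDF) , noPeak) =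
  (injective , λ i → <-≤-trans (below i) (underDF (toℕ i))) ,
  (λ V _ → greedy⇒avoids213 P (colHFrom-antitone n D0) V) ,
  λ { (x , y) V∈ occ → let Q , Q∈ , Qx<x , Qy<y = greedy321⇒peak {D0 = D0} dy0 P x y occ in
        noPeak (x , y) V∈ Q Q∈ (Qx<x , Qy<y) }
  where
  P : GreedyPlacement (colH n D0) (fillPlacement D0 dy0)
  P = fillPlacement-greedy D0 dy0
  open GreedyPlacement P

lemma6p7 : (n : ℕ) (DF : List Step) → IsDyck n DF →
    ((σ : Vec (Fin n) n) → R213-321 n DF σ →
       Σ (List Step) λ D0 → IsBorderOfFR n σ D0 × InA2 n D0 DF) ×
    ((σ σ′ : Vec (Fin n) n) (D0 : List Step) →
       R213-321 n DF σ → R213-321 n DF σ′ →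
       IsBorderOfFR n σ D0 → IsBorderOfFR n σ′ D0 → σ ≡ σ′) ×
    ((D0 : List Step) → InA2 n D0 DF →
       Σ (Vec (Fin n) n) λ σ → R213-321 n DF σ × IsBorderOfFR n σ D0)
lemma6p7 n DF dyF =
  (λ σ R@((inj , _) , _) →
     minBoard n σ , minBoard-border σ inj , minBoard-inA2 {σ = σ} dyF R) ,
  (λ σ σ′ D0 (P , av , _) (P′ , av′ , _) →
     border213-unique {D0 = D0} {σ} {σ′} dyF (P , av) (P′ , av′)) ,
  (λ D0 A@((dy0 , _) , _) →
     fillPlacement D0 dy0 , fillPlacement-avoids {D0 = D0} A , fillPlacement-border D0 dy0)
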